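{- For every agent $a\in A$: (1) $\mathrm{Exp}_a\leftrightarrow K_a\mathrm{Exp}_a$ is valid; (2) $\neg\mathrm{Exp}_a\leftrightarrow K_a\neg\mathrm{Exp}_a$ is valid; (3) $\mathrm{cExp}_a\leftrightarrow K_a\mathrm{cExp}_a$ is not valid, i.e. there is a gossip state at which it is false (for a suitable choice of the agent set $A$).
   Context: Fix a finite set $A$ of agents, $|A|\ge 2$. Secret values are the elements of $A\times\{0,1\}$; write $b$ for $(b,1)$ and $\overline{b}$ for $(b,0)$. For $B\subseteq A\times\{0,1\}$ and $c\in A$, $B^{\pm c}$ is $B$ with the values $c$ and $\overline c$ swapped: simultaneously, $c$ is replaced by $\overline c$ and $\overline c$ by $c$. A secret distribution is a map $S:A\to\mathcal P(A\times\{0,1\})$, $a\mapsto S_a$ (the holding of $a$). An initial secret distribution $I$ satisfies $I_a\in\{\{a\},\{\overline a\}\}$ for every $a$. Calls: for $a\neq b$ in $A$ and $c\in A$ there is the correct call $ab$ (agent $a$ calls $b$ and they exchange their holdings), the faulty call $a^cb$ (from $a$ to $b$, with a transmission error on secret $c$ in what $a$ sends, so that $b$ receives $a$'s holding with the values of $c$ swapped), and the faulty call $ab^c$ (from $a$ to $b$, with a transmission error on secret $c$ in what $b$ sends to $a$). A call sequence is a finite sequence of calls containing at most one faulty call. $\epsilon$ is the empty sequence and $\sigma.\kappa$ appends the call $\kappa$. A gossip state is a pair $(I,\sigma)$ with $I$ initial and $\sigma$ a call sequence. Formulas: $\varphi::=b_a\mid\overline b_a\mid\neg\varphi\mid\varphi\wedge\varphi\mid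 K_a\varphi$ with $a,b\in A$. Abbreviations: - $\mathrm{Exp}_a:=\bigwedge_{b\in A}((b_a\wedge\neg\overline b_a)\vee(\neg b_a\wedge\overline b_a))$; - $\mathrm{cExp}_a:=\bigwedge_{b\in A}((b_b\wedge b_a\wedge\neg\overline b_a)\vee(\overline b_b\wedge\neg b_a\wedge\overline b_a))$. The following three notions are defined by simultaneous recursion on the length of the call sequence and on the structure of formulas. (1) Secret distribution after a call sequence. $I[\epsilon]=I$. Let $a\neq b$. If the call $\kappa$ does not involve $a$, then $I[\sigma.\kappa]_a=I[\sigma]_a$. If $\kappa\in\{ab,ba,a^cb,ba^c\}$, let $R=I[\sigma]_b$; if $\kappa\in\{ab^c,b^ca\}$, let $R=I[\sigma]_b^{\pm c}$. Then $I[\sigma.\kappa]_a=(I[\sigma]_a\cup(R\setminus *))\setminus **$, where $*=\{d: I,\sigma\models K_a\overline d_d\}\cup\{\overline d: I,\sigma\models K_a d_d\}$, and $**$ is the set of values $d$ such that $T,\tau\models\overline d_d$ for all gossip states $(T,\tau)$ with $(I,\sigma)\sim_a(T,\tau)$ and $I[\sigma]_b=T[\tau]_b$, together with the values $\overline d$ such that $T,\tau\models d_d$ for all such $(T,\tau)$. When $\kappa\in\{ab^c,b^ca\}$, the condition $I[\sigma]_b=T[\tau]_b$ is replaced by $I[\sigma]_b=T[\tau]_b^{\pm c}$. (2) Observation relation. $\sim_a$ is the equivalence closure of the following clauses, for $b\neq a$ and $e\in A$: - $(I,\epsilon)\sim_a(T,\epsilon)$ iff $I_a=T_a$; - $(I,\sigma.ab)\sim_a(T,\tau.ab)$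 iff $(I,\sigma)\sim_a(T,\tau)$ and $I[\sigma]_b=T[\tau]_b$; - $(I,\sigma.ab)\sim_a(T,\tau.a^eb)$ iff $(I,\sigma)\sim_a(T,\tau)$ and $I[\sigma]_b=T[\tau]_b$; - $(I,\sigma.ab)\sim_a(T,\tau.ab^e)$ iff $(I,\sigma)\sim_a(T,\tau)$ and $I[\sigma]_b=T[\tau]_b^{\pm e}$; - the same three clauses with $ba,ba^e,b^ea$ in place of $ab,a^eb,ab^e$; - for a call $\kappa$ (correct or faulty) and a correct call $\kappa'$, neither involving $a$: $(I,\sigma.\kappa)\sim_a(T,\tau.\kappa')$ iff $(I,\sigma)\sim_a(T,\tau)$. Only pairs whose components are call sequences are related. (3) Satisfaction. - $I,\sigma\models b_a$ iff $b\in I[\sigma]_a$; - $I,\sigma\models\overline b_a$ iff $\overline b\in I[\sigma]_a$; - the Boolean clauses are standard; - $I,\sigma\models K_a\varphi$ iff $T,\tau\models\varphi$ for all gossip states $(T,\tau)$ with $(T,\tau)\sim_a(I,\sigma)$. A formula is valid if it is true at every gossip state. -}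

module Defs where

open import Data.Nat using (ℕ; zero; suc; _≤_)
open import Data.Fin using (Fin; _≟_)
open import Data.Bool using (Bool; true; false; not)
open import Data.Product using (_×_; _,_)
open import Data.Sum using (_⊎_)
open import Data.Maybe using (Maybe; just; nothing)
open import Data.Vec using (allFin; map; foldr₁)
open import Relation.Nullary using (¬_; yes; no)
open import Relation.Binary.PropositionalEquality using (_≡_; _≢_)
open import Relation.Binary.Construct.Closure.Equivalence using (EqClosure)

-- Everything is parameterised by k; the agent set is A = Fin (2 + k),
-- so |A| ≥ 2 is built in and every finite A with |A| ≥ 2 is covered
-- (up to renaming of agents).
module _ (k : ℕ) where

  Agent : Set
  Agent = Fin (suc (suc k))

  -- secret values A × {0,1}: (b , true) is b, (b , false) is b̄
  Value : Set
  Value = Agent × Bool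

  Holding : Set₁
  Holding = Value → Set

  Initial : Set
  Initial = Agent → Bool

  initHolding : Initial → Agent → Holding
  initHolding I a x = x ≡ (a , I a)

  swapV : Agent → Value → Value
  swapV c (d , v) with c ≟ d
  ... | yes _ = (d , not v)
  ... | no _  = (d , v)

  _^±_ : Holding → Agent → Holding
  (B ^± c) x = B (swapV c x)

  _≐_ : Holding → Holding → Set
  P ≐ Q = ∀ x → (P x → Q x) × (Q x → P x)

  data Kind : Set where
    ok      : Kind
    errFrom : Agent → Kind    -- a^c b : error on c in what the caller sends
    errTo   : Agent → Kind    -- a b^c : error on c in what the callee sends

  record Call : Set where
    constructor call
    field
      from     : Agent
      to       : Agent
      distinct : from ≢ to
      kind     : Kind

  infixl 5 _∙_
  data Seq : ℕ → Set where
    ε   : Seq 0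
    _∙_ : ∀ {m} → Seq m → Call → Seq (suc m)

  faultyK : Kind → ℕ
  faultyK ok          = 0
  faultyK (errFrom _) = 1
  faultyK (errTo _)   = 1

  faults : ∀ {m} → Seq m → ℕ
  faults ε       = 0
  faults (σ ∙ κ) = faultyK (Call.kind κ) Data.Nat.+ faults σ

  IsCallSeq : ∀ {m} → Seq m → Set
  IsCallSeq σ = faults σ ≤ 1

  infixr 6 _∧'_
  data Form : Set where
    atom : Agent → Agent → Bool → Form   -- atom b a true = b_a ; atom b a false = b̄_a
    ¬'_  : Form → Form
    _∧'_ : Form → Form → Form
    K    : Agent → Form → Form

  infixr 5 _∨'_
  _∨'_ : Form → Form → Form
  φ ∨' ψ = ¬' (¬' φ ∧' ¬' ψ)

  infix 4 _↔'_
  _↔'_ : Form → Form → Form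
  φ ↔' ψ = ¬' (φ ∧' ¬' ψ) ∧' ¬' (ψ ∧' ¬' φ)

  -- the role of agent a in a call: absent, or partner b together with
  -- the secret (if any) on which a RECEIVES an error
  data Role : Set where
    absent  : Role
    partner : Agent → Maybe Agent → Role

  recvErrCaller : Kind → Maybe Agent   -- a is the caller: error in what callee sends
  recvErrCaller (errTo c) = just c
  recvErrCaller _         = nothing

  recvErrCallee : Kind → Maybe Agent   -- a is the callee: error in what caller sends
  recvErrCallee (errFrom c) = just c
  recvErrCallee _           = nothing

  role : Agent → Call → Role
  role a (call f t _ κ) with a ≟ f | a ≟ t
  ... | yes _ | _     = partner t (recvErrCaller κ)
  ... | no _  | yes _ = partner f (recvErrCallee κ)
  ... | no _  | no _  = absent

  GState : ℕ → Set
  GState m = Initial × Seq m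

  -- the data available for call sequences of length m:
  -- secret distributions I[σ] and the observation relations ∼_a
  record Level (m : ℕ) : Set₁ where
    field
      hold : Initial → Seq m → Agent → Holding
      rel  : Agent → GState m → GState m → Set

  sat : ∀ {m} → Level m → Initial → Seq m → Form → Set
  sat L I σ (atom b a v) = Level.hold L I σ a (b , v)
  sat L I σ (¬' φ)       = ¬ sat L I σ φ
  sat L I σ (φ ∧' ψ)     = sat L I σ φ × sat L I σ ψ
  sat {m} L I σ (K a φ)  =
    ∀ (T : Initial) (τ : Seq m) → IsCallSeq τ →
      Level.rel L a (T , τ) (I , σ) → sat L T τ φ

  data Gen0 (a : Agent) : GState 0 → GState 0 → Set where
    base : ∀ {I T} → initHolding I a ≐ initHolding T a →
           Gen0 a (I , ε) (T , ε)

  data GenS {m} (L : Level m) (a : Agent) : GState (suc m) → GState (suc m) → Set where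
    ab-ab   : ∀ {I T σ τ b} (p p' : a ≢ b) → Level.rel L a (I , σ) (T , τ) →
              Level.hold L I σ b ≐ Level.hold L T τ b →
              GenS L a (I , σ ∙ call a b p ok) (T , τ ∙ call a b p' ok)
    ab-aeb  : ∀ {I T σ τ b e} (p p' : a ≢ b) → Level.rel L a (I , σ) (T , τ) →
              Level.hold L I σ b ≐ Level.hold L T τ b →
              GenS L a (I , σ ∙ call a b p ok) (T , τ ∙ call a b p' (errFrom e))
    ab-abe  : ∀ {I T σ τ b e} (p p' : a ≢ b) → Level.rel L a (I , σ) (T , τ) →
              Level.hold L I σ b ≐ (Level.hold L T τ b ^± e) →
              GenS L a (I , σ ∙ call a b p ok) (T , τ ∙ call a b p' (errTo e))
    ba-ba   : ∀ {I T σ τ b} (p p' : b ≢ a) → Level.rel L a (I , σ) (T , τ) →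
              Level.hold L I σ b ≐ Level.hold L T τ b →
              GenS L a (I , σ ∙ call b a p ok) (T , τ ∙ call b a p' ok)
    ba-bae  : ∀ {I T σ τ b e} (p p' : b ≢ a) → Level.rel L a (I , σ) (T , τ) →
              Level.hold L I σ b ≐ Level.hold L T τ b →
              GenS L a (I , σ ∙ call b a p ok) (T , τ ∙ call b a p' (errTo e))
    ba-bea  : ∀ {I T σ τ b e} (p p' : b ≢ a) → Level.rel L a (I , σ) (T , τ) →
              Level.hold L I σ b ≐ (Level.hold L T τ b ^± e) →
              GenS L a (I , σ ∙ call b a p ok) (T , τ ∙ call b a p' (errFrom e))
    other   : ∀ {I T σ τ} (κ κ' : Call) →
              a ≢ Call.from κ → a ≢ Call.to κ →
              a ≢ Call.from κ' → a ≢ Call.to κ' → Call.kind κ' ≡ ok →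
              Level.rel L a (I , σ) (T , τ) →
              GenS L a (I , σ ∙ κ) (T , τ ∙ κ')

  Restrict : ∀ {m} → (GState m → GState m → Set) → GState m → GState m → Set
  Restrict G (I , σ) (T , τ) = IsCallSeq σ × IsCallSeq τ × G (I , σ) (T , τ)

  level0 : Level 0
  level0 = record { hold = h ; rel = λ a → EqClosure (Restrict (Gen0 a)) }
    where
      h : Initial → Seq 0 → Agent → Holding
      h I ε a = initHolding I a

  matchB : Maybe Agent → Holding → Holding → Set
  matchB nothing  P Q = P ≐ Q
  matchB (just c) P Q = P ≐ (Q ^± c)

  recv : Maybe Agent → Holding → Holding
  recv nothing  R = R
  recv (just c) R = R ^± c

  step : ∀ {m} → Level m → Level (suc m)
  step {m} L = record { hold = hold' ; rel = λ a → EqClosure (Restrict (GenS L a)) }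
    where
      open Level L
      star : Agent → Initial → Seq m → Holding
      star a I σ (d , true)  = sat L I σ (K a (atom d d false))
      star a I σ (d , false) = sat L I σ (K a (atom d d true))
      star2 : Agent → Agent → Maybe Agent → Initial → Seq m → Holding
      star2 a b err I σ (d , v) =
        ∀ (T : Initial) (τ : Seq m) → IsCallSeq τ → rel a (I , σ) (T , τ) →
          matchB err (hold I σ b) (hold T τ b) → sat L T τ (atom d d (not v))
      hold' : Initial → Seq (suc m) → Agent → Holding
      hold' I (σ ∙ κ) a with role a κ
      ... | absent        = hold I σ a
      ... | partner b err = λ x →
              (hold I σ a x ⊎ (recv err (hold I σ b) x × ¬ star a I σ x))
              × ¬ star2 a b err I σ x

  level : ∀ m → Level m
  level zero    = level0
  level (suc m) = step (level m)

  Sat : ∀ {m} → Initial → Seq m → Form → Set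
  Sat {m} I σ φ = sat (level m) I σ φ

  Valid : Form → Set
  Valid φ = ∀ (m : ℕ) (I : Initial) (σ : Seq m) → IsCallSeq σ → Sat I σ φ

  ⋀ : (Agent → Form) → Form
  ⋀ f = foldr₁ _∧'_ (map f (allFin (suc (suc k))))

  Exp : Agent → Form
  Exp a = ⋀ λ b → (atom b a true ∧' ¬' atom b a false) ∨' (¬' atom b a true ∧' atom b a false)

  cExp : Agent → Form
  cExp a = ⋀ λ b → (atom b b true ∧' atom b a true ∧' ¬' atom b a false)
                ∨' (atom b b false ∧' ¬' atom b a true ∧' atom b a false)

{-# OPTIONS --safe #-}
module Submission where

-- The observation clauses only relate states in which the observer ends up
-- with the same holding, so ∼ₐ preserves a's holding.  A formula built from
-- atoms about a's own holding, such as Exp a, is therefore known by a exactly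
-- when it holds.  cExp a also speaks about the other agents' own secrets,
-- which a cannot observe: with two agents a and b, after the correct call ab
-- from the all-true distribution, a cannot rule out the call ab^b from the
-- distribution in which b holds b̄, because b's garbled reply b̄ arrives as b.
-- So cExp a holds there without being known.

open import Defs
open import Data.Nat using (ℕ; zero; suc; z≤n; s≤s)
open import Data.Fin using (zero; suc; _≟_)
open import Data.Bool using (true; false; not)
open import Data.Bool.Properties using (not-involutive)
open import Data.Product using (Σ; _×_; _,_; proj₁; proj₂)
open import Data.Sum using (_⊎_; inj₁; inj₂)
open import Data.Empty using (⊥-elim)
open import Data.Maybe using (Maybe; just; nothing)
open import Data.Vec using (Vec; _∷_; []; map; allFin; foldr₁; lookup)
open import Data.Vec.Properties using (lookup-allFin)
open import Function using (id; _∘_)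
open import Relation.Nullary using (¬_; yes; no; does)
open import Relation.Nullary.Decidable using (dec-true; dec-false)
open import Relation.Binary using (IsEquivalence)
open import Relation.Binary.PropositionalEquality
open import Relation.Binary.Construct.Closure.ReflexiveTransitive using (ε)
import Relation.Binary.Construct.Closure.Equivalence as EqClosure

module Gossip (k : ℕ) where

  infix 4 _≐ₕ_ _∼[_]_

  _≐ₕ_ : Holding k → Holding k → Set
  _≐ₕ_ = _≐_ k

  ≐-refl : ∀ {P} → P ≐ₕ P
  ≐-refl x = id , id

  ≐-sym : ∀ {P Q} → P ≐ₕ Q → Q ≐ₕ P
  ≐-sym P≐Q x = proj₂ (P≐Q x) , proj₁ (P≐Q x)

  ≐-trans : ∀ {P Q R} → P ≐ₕ Q → Q ≐ₕ R → P ≐ₕ R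
  ≐-trans P≐Q Q≐R x =
    proj₁ (Q≐R x) ∘ proj₁ (P≐Q x) , proj₂ (P≐Q x) ∘ proj₂ (Q≐R x)

  ≐-isEquivalence : IsEquivalence _≐ₕ_
  ≐-isEquivalence = record { refl = ≐-refl ; sym = ≐-sym ; trans = ≐-trans }

  swapV-self : ∀ c v → swapV k c (c , v) ≡ (c , not v)
  swapV-self c v with c ≟ c
  ... | yes _  = refl
  ... | no c≢c = ⊥-elim (c≢c refl)

  swapV-other : ∀ {c d} v → c ≢ d → swapV k c (d , v) ≡ (d , v)
  swapV-other {c} {d} v c≢d with c ≟ d
  ... | yes c≡d = ⊥-elim (c≢d c≡d)
  ... | no _    = refl

  swapV-involutive : ∀ c x → swapV k c (swapV k c x) ≡ x
  swapV-involutive c (d , v) with c ≟ d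
  ... | yes refl = trans (swapV-self c (not v)) (cong (c ,_) (not-involutive v))
  ... | no c≢d   = swapV-other v c≢d

  recv-cong : ∀ e {P Q} → P ≐ₕ Q → recv k e P ≐ₕ recv k e Q
  recv-cong nothing  P≐Q   = P≐Q
  recv-cong (just c) P≐Q x = P≐Q (swapV k c x)

  recv-involutive : ∀ e P → recv k e (recv k e P) ≐ₕ P
  recv-involutive nothing  P   = ≐-refl
  recv-involutive (just c) P x =
    subst P (swapV-involutive c x) , subst P (sym (swapV-involutive c x))

  matchB⇒recv≐ : ∀ e {P Q} → matchB k e P Q → recv k e P ≐ₕ Q
  matchB⇒recv≐ nothing  P≐Q = P≐Q
  matchB⇒recv≐ (just c) {Q = Q} P≐Q^c =
    ≐-trans (recv-cong (just c) P≐Q^c) (recv-involutive (just c) Q)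

  recv≐⇒matchB : ∀ e {P Q} → recv k e P ≐ₕ Q → matchB k e P Q
  recv≐⇒matchB nothing  P≐Q = P≐Q
  recv≐⇒matchB (just c) {P} P^c≐Q =
    ≐-trans (≐-sym (recv-involutive (just c) P)) (recv-cong (just c) P^c≐Q)

  matchB-transport : ∀ e₁ e₂ {P P' Q} → recv k e₁ P ≐ₕ recv k e₂ P' →
                     matchB k e₁ P Q → matchB k e₂ P' Q
  matchB-transport e₁ e₂ same matched =
    recv≐⇒matchB e₂ (≐-trans (≐-sym same) (matchB⇒recv≐ e₁ matched))

  initHolding-flip : ∀ {I T} b → I b ≡ not (T b) →
                     initHolding k I b ≐ₕ _^±_ k (initHolding k T b) b
  initHolding-flip {I} {T} b Ib≡¬Tb x = to , from
    where
      open ≡-Reasoning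
      to : x ≡ (b , I b) → swapV k b x ≡ (b , T b)
      to refl = begin
        swapV k b (b , I b)   ≡⟨ swapV-self b (I b) ⟩
        (b , not (I b))       ≡⟨ cong (λ v → b , not v) Ib≡¬Tb ⟩
        (b , not (not (T b))) ≡⟨ cong (b ,_) (not-involutive (T b)) ⟩
        (b , T b)             ∎
      from : swapV k b x ≡ (b , T b) → x ≡ (b , I b)
      from eq = begin
        x                       ≡⟨ sym (swapV-involutive b x) ⟩
        swapV k b (swapV k b x) ≡⟨ cong (swapV k b) eq ⟩
        swapV k b (b , T b)     ≡⟨ swapV-self b (T b) ⟩
        (b , not (T b))         ≡⟨ cong (b ,_) (sym Ib≡¬Tb) ⟩
        (b , I b)               ∎

  -- level k m computes only once m is a constructor, so unification cannot
  -- recover the length m (nor what hides behind hold); such implicit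
  -- arguments are passed explicitly below.
  hold : ∀ {m} → Initial k → Seq k m → Agent k → Holding k
  hold {m} = Level.hold (level k m)

  holding : ∀ {m} → GState k m → Agent k → Holding k
  holding (I , σ) = hold I σ

  _∼[_]_ : ∀ {m} → GState k m → Agent k → GState k m → Set
  s ∼[ a ] t = Level.rel (level k _) a s t

  ∼-refl : ∀ {m a} {s : GState k m} → s ∼[ a ] s
  ∼-refl {zero}  = ε
  ∼-refl {suc m} = ε

  ∼-sym : ∀ {m a} {s t : GState k m} → s ∼[ a ] t → t ∼[ a ] s
  ∼-sym {zero}  = EqClosure.symmetric _
  ∼-sym {suc m} = EqClosure.symmetric _

  ∼-trans : ∀ {m a} {s t u : GState k m} → s ∼[ a ] t → t ∼[ a ] u → s ∼[ a ] u
  ∼-trans {zero}  = EqClosure.transitive _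
  ∼-trans {suc m} = EqClosure.transitive _

  ∼-ε : ∀ {a I T} → I a ≡ T a → (I , ε) ∼[ a ] (T , ε)
  ∼-ε {a} Ia≡Ta = EqClosure.return (z≤n , z≤n , base λ x →
    (λ e → trans e (cong (a ,_) Ia≡Ta)) , (λ e → trans e (cong (a ,_) (sym Ia≡Ta))))

  K-veridical : ∀ {m a φ I} {σ : Seq k m} → IsCallSeq k σ →
                Sat k I σ (K a φ) → Sat k I σ φ
  K-veridical {m} {I = I} {σ} c known = known I σ c (∼-refl {m})

  K-∼-invariant : ∀ {m a φ I T} {σ τ : Seq k m} → (I , σ) ∼[ a ] (T , τ) →
                  Sat k I σ (K a φ) → Sat k T τ (K a φ)
  K-∼-invariant {m} r known T' τ' c r' = known T' τ' c (∼-trans {m} r' (∼-sym {m} r))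

  role-caller : ∀ {a b κ} (p : a ≢ b) →
                role k a (call a b p κ) ≡ partner b (recvErrCaller k κ)
  role-caller {a} {b} p with a ≟ a | a ≟ b
  ... | yes _  | _ = refl
  ... | no a≢a | _ = ⊥-elim (a≢a refl)

  role-callee : ∀ {a b κ} (p : b ≢ a) →
                role k a (call b a p κ) ≡ partner b (recvErrCallee k κ)
  role-callee {a} {b} p with a ≟ b | a ≟ a
  ... | yes a≡b | _      = ⊥-elim (p (sym a≡b))
  ... | no _    | yes _  = refl
  ... | no _    | no a≢a = ⊥-elim (a≢a refl)

  role-absent : ∀ {a} (κ : Call k) → a ≢ Call.from κ → a ≢ Call.to κ → role k a κ ≡ absent
  role-absent {a} (call f t _ _) a≢f a≢t with a ≟ f | a ≟ t
  ... | yes a≡f | _       = ⊥-elim (a≢f a≡f)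
  ... | no _    | yes a≡t = ⊥-elim (a≢t a≡t)
  ... | no _    | no _    = refl

  KnowsNot : ∀ {m} → Agent k → Initial k → Seq k m → Value k → Set
  KnowsNot a I σ (d , v) = Sat k I σ (K a (atom d d (not v)))

  Excluded : ∀ {m} → Agent k → Agent k → Maybe (Agent k) → Initial k → Seq k m →
             Value k → Set
  Excluded {m} a b e I σ (d , v) =
    ∀ T (τ : Seq k m) → IsCallSeq k τ → (I , σ) ∼[ a ] (T , τ) →
      matchB k e (hold I σ b) (hold T τ b) → Sat k T τ (atom d d (not v))

  Updated : ∀ {m} → Agent k → Agent k → Maybe (Agent k) → Initial k → Seq k m → Holding k
  Updated a b e I σ x =
    (hold I σ a x ⊎ (recv k e (hold I σ b) x × ¬ KnowsNot a I σ x)) × ¬ Excluded a b e I σ x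

  hold-∙-absent : ∀ {m a I κ} {σ : Seq k m} → role k a κ ≡ absent →
                  hold I (σ ∙ κ) a ≡ hold I σ a
  hold-∙-absent {a = a} {κ = κ} r with role k a κ
  hold-∙-absent refl | .absent = refl

  hold-∙⇒Updated : ∀ {m a b e I κ x} {σ : Seq k m} → role k a κ ≡ partner b e →
                   hold I (σ ∙ κ) a x → Updated a b e I σ x
  hold-∙⇒Updated {a = a} {κ = κ} r with role k a κ
  hold-∙⇒Updated {x = _ , true}  refl | .(partner _ _) = id
  hold-∙⇒Updated {x = _ , false} refl | .(partner _ _) = id

  Updated⇒hold-∙ : ∀ {m a b e I κ x} {σ : Seq k m} → role k a κ ≡ partner b e →
                   Updated a b e I σ x → hold I (σ ∙ κ) a x
  Updated⇒hold-∙ {a = a} {κ = κ} r with role k a κ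
  Updated⇒hold-∙ {x = _ , true}  refl | .(partner _ _) = id
  Updated⇒hold-∙ {x = _ , false} refl | .(partner _ _) = id

  hold-∙-⊆ : ∀ {m a b e I κ x} {σ : Seq k m} → role k a κ ≡ partner b e →
             hold I (σ ∙ κ) a x → hold I σ a x ⊎ recv k e (hold I σ b) x
  hold-∙-⊆ {a = a} {I = I} {κ} {x} {σ} r held
    with proj₁ (hold-∙⇒Updated {a = a} {I = I} {κ = κ} {x} {σ} r held)
  ... | inj₁ own            = inj₁ own
  ... | inj₂ (received , _) = inj₂ received

  -- In a correct transmission a only excludes values already refuted by the
  -- actual state, since that state is among those a considers possible.
  hold-∙-correct : ∀ {m a b I κ d v} {σ : Seq k m} →
                   role k a κ ≡ partner b nothing → IsCallSeq k σ →
                   hold I σ a (d , v) ⊎ hold I σ b (d , v) → ¬ Sat k I σ (atom d d (not v)) →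
                   hold I (σ ∙ κ) a (d , v)
  hold-∙-correct {m} {a} {b} {I} {κ} {d} {v} {σ} r c held refuted =
    Updated⇒hold-∙ {a = a} {I = I} {κ = κ} {x = d , v} {σ} r (kept held , ¬excluded)
    where
      kept : hold I σ a (d , v) ⊎ hold I σ b (d , v) →
             hold I σ a (d , v) ⊎ (hold I σ b (d , v) × ¬ KnowsNot a I σ (d , v))
      kept (inj₁ own)      = inj₁ own
      kept (inj₂ received) = inj₂ (received , refuted ∘ K-veridical {σ = σ} c)
      ¬excluded : ¬ Excluded a b nothing I σ (d , v)
      ¬excluded excluded = refuted (excluded I σ c (∼-refl {m}) ≐-refl)

  Updated-⊆ : ∀ {m a b e₁ e₂ I T x} {σ τ : Seq k m} → (I , σ) ∼[ a ] (T , τ) →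
              hold I σ a ≐ₕ hold T τ a → recv k e₁ (hold I σ b) ≐ₕ recv k e₂ (hold T τ b) →
              Updated a b e₁ I σ x → Updated a b e₂ T τ x
  Updated-⊆ {m} {a} {b} {e₁} {e₂} {I} {T} {x} {σ} {τ} r same-own same-received
            (kept , ¬excluded) = kept' kept , ¬excluded ∘ excluded'
    where
      kept' : hold I σ a x ⊎ (recv k e₁ (hold I σ b) x × ¬ KnowsNot a I σ x) →
              hold T τ a x ⊎ (recv k e₂ (hold T τ b) x × ¬ KnowsNot a T τ x)
      kept' (inj₁ own) = inj₁ (proj₁ (same-own x) own)
      kept' (inj₂ (received , ¬knows)) =
        inj₂ (proj₁ (same-received x) received , ¬knows ∘ K-∼-invariant {σ = τ} (∼-sym {m} r))
      excluded' : Excluded a b e₂ T τ x → Excluded a b e₁ I σ x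
      excluded' excluded T' τ' c r' matched =
        excluded T' τ' c (∼-trans {m} (∼-sym {m} r) r')
                 (matchB-transport e₁ e₂ same-received matched)

  hold-∙-cong : ∀ {m a b e₁ e₂ I T κ κ'} {σ τ : Seq k m} →
                role k a κ ≡ partner b e₁ → role k a κ' ≡ partner b e₂ →
                (I , σ) ∼[ a ] (T , τ) → hold I σ a ≐ₕ hold T τ a →
                recv k e₁ (hold I σ b) ≐ₕ recv k e₂ (hold T τ b) →
                hold I (σ ∙ κ) a ≐ₕ hold T (τ ∙ κ') a
  hold-∙-cong {m} {a} {b} {e₁} {e₂} {I} {T} {κ} {κ'} {σ} {τ} r₁ r₂ r same-own same-received x =
      Updated⇒hold-∙ {a = a} {I = T} {κ = κ'} {x = x} {τ} r₂
    ∘ Updated-⊆ {e₁ = e₁} {σ = σ} r same-own same-received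
    ∘ hold-∙⇒Updated {a = a} {I = I} {κ = κ} {x = x} {σ} r₁
    ,
      Updated⇒hold-∙ {a = a} {I = I} {κ = κ} {x = x} {σ} r₁
    ∘ Updated-⊆ {e₁ = e₂} {σ = τ} (∼-sym {m} r) (≐-sym same-own) (≐-sym same-received)
    ∘ hold-∙⇒Updated {a = a} {I = T} {κ = κ'} {x = x} {τ} r₂

  ∼⇒≐ : ∀ {m a} {s t : GState k m} → s ∼[ a ] t → holding s a ≐ₕ holding t a
  ∼⇒≐ {zero} {a} =
    EqClosure.gfold ≐-isEquivalence (λ s → holding s a) λ { (_ , _ , base same) → same }
  ∼⇒≐ {suc m} {a} = EqClosure.gfold ≐-isEquivalence (λ s → holding s a) generator
    where
      generator : ∀ {s t} → Restrict k (GenS k (level k m) a) s t → holding s a ≐ₕ holding t a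
      generator {_ , _ ∙ κ} {_ , _ ∙ κ'} (_ , _ , ab-ab p p' r same) =
        hold-∙-cong {m} {κ = κ} {κ'} (role-caller p) (role-caller p') r (∼⇒≐ {m} r) same
      generator {_ , _ ∙ κ} {_ , _ ∙ κ'} (_ , _ , ab-aeb p p' r same) =
        hold-∙-cong {m} {κ = κ} {κ'} (role-caller p) (role-caller p') r (∼⇒≐ {m} r) same
      generator {_ , _ ∙ κ} {_ , _ ∙ κ'} (_ , _ , ab-abe p p' r same) =
        hold-∙-cong {m} {κ = κ} {κ'} (role-caller p) (role-caller p') r (∼⇒≐ {m} r) same
      generator {_ , _ ∙ κ} {_ , _ ∙ κ'} (_ , _ , ba-ba p p' r same) =
        hold-∙-cong {m} {κ = κ} {κ'} (role-callee p) (role-callee p') r (∼⇒≐ {m} r) same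
      generator {_ , _ ∙ κ} {_ , _ ∙ κ'} (_ , _ , ba-bae p p' r same) =
        hold-∙-cong {m} {κ = κ} {κ'} (role-callee p) (role-callee p') r (∼⇒≐ {m} r) same
      generator {_ , _ ∙ κ} {_ , _ ∙ κ'} (_ , _ , ba-bea p p' r same) =
        hold-∙-cong {m} {κ = κ} {κ'} (role-callee p) (role-callee p') r (∼⇒≐ {m} r) same
      generator {I , σ ∙ _} {T , τ ∙ _} (_ , _ , other κ κ' a≢f a≢t a≢f' a≢t' _ r) =
        subst₂ _≐ₕ_ (sym (hold-∙-absent {m} {a} {I} {κ} {σ} (role-absent κ a≢f a≢t)))
                    (sym (hold-∙-absent {m} {a} {T} {κ'} {τ} (role-absent κ' a≢f' a≢t')))
                    (∼⇒≐ {m} r)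

  data Local (a : Agent k) : Form k → Set where
    local-atom : ∀ b v → Local a (atom b a v)
    local-¬    : ∀ {φ} → Local a φ → Local a (¬' φ)
    local-∧    : ∀ {φ ψ} → Local a φ → Local a ψ → Local a (φ ∧' ψ)

  sat-local : ∀ {m a φ I T} {σ τ : Seq k m} → Local a φ → hold I σ a ≐ₕ hold T τ a →
              Sat k I σ φ → Sat k T τ φ
  sat-local     (local-atom b v) same        = proj₁ (same (b , v))
  sat-local {m} (local-¬ l)      same ¬φ     = ¬φ ∘ sat-local {m} l (≐-sym same)
  sat-local {m} (local-∧ l l')   same (φ , ψ) = sat-local {m} l same φ , sat-local {m} l' same ψ

  ⋀-closed : (P : Form k → Set) → (∀ {φ ψ} → P φ → P ψ → P (φ ∧' ψ)) →
             ∀ {f} → (∀ b → P (f b)) → P (⋀ k f)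
  ⋀-closed P P-∧ {f} Pf = foldr₁-closed (allFin _)
    where
      foldr₁-closed : ∀ {n} (bs : Vec (Agent k) (suc n)) → P (foldr₁ _∧'_ (map f bs))
      foldr₁-closed (b ∷ [])     = Pf b
      foldr₁-closed (b ∷ c ∷ bs) = P-∧ (Pf b) (foldr₁-closed (c ∷ bs))

  ⋀-elim : ∀ {m I f} {σ : Seq k m} → Sat k I σ (⋀ k f) → ∀ b → Sat k I σ (f b)
  ⋀-elim {m} {I} {f} {σ} all b =
    subst (λ c → Sat k I σ (f c)) (lookup-allFin b) (foldr₁-elim (allFin _) all b)
    where
      foldr₁-elim : ∀ {n} (bs : Vec (Agent k) (suc n)) → Sat k I σ (foldr₁ _∧'_ (map f bs)) →
                    ∀ i → Sat k I σ (f (lookup bs i))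
      foldr₁-elim (b ∷ [])     φ        zero    = φ
      foldr₁-elim (b ∷ c ∷ bs) (φ , _)  zero    = φ
      foldr₁-elim (b ∷ c ∷ bs) (_ , φs) (suc i) = foldr₁-elim (c ∷ bs) φs i

  Exp-local : ∀ a → Local a (Exp k a)
  Exp-local a = ⋀-closed (Local a) local-∧ λ b →
    local-∨ (local-∧ (local-atom b true) (local-¬ (local-atom b false)))
            (local-∧ (local-¬ (local-atom b true)) (local-atom b false))
    where
      local-∨ : ∀ {φ ψ} → Local a φ → Local a ψ → Local a (_∨'_ k φ ψ)
      local-∨ l l' = local-¬ (local-∧ (local-¬ l) (local-¬ l'))

  ↔-intro : ∀ {m I φ ψ} {σ : Seq k m} →
            (Sat k I σ φ → Sat k I σ ψ) → (Sat k I σ ψ → Sat k I σ φ) →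
            Sat k I σ (_↔'_ k φ ψ)
  ↔-intro φ⇒ψ ψ⇒φ = (λ (φ , ¬ψ) → ¬ψ (φ⇒ψ φ)) , (λ (ψ , ¬φ) → ¬φ (ψ⇒φ ψ))

  local-introspective : ∀ {a φ} → Local a φ → Valid k (_↔'_ k φ (K a φ))
  local-introspective {a} {φ} l m I σ c =
    ↔-intro {m} {I} {φ} {K a φ} {σ} known-if-true (K-veridical {m} {a} {φ} {I} {σ} c)
    where
      known-if-true : Sat k I σ φ → Sat k I σ (K a φ)
      known-if-true holds T τ _ r = sat-local {m} {σ = σ} l (≐-sym (∼⇒≐ {m} r)) holds

module TwoAgents where
  open Gossip 0

  opposite : Agent 0 → Agent 0
  opposite zero       = suc zero
  opposite (suc zero) = zero

  opposite-≢ : ∀ a → a ≢ opposite a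
  opposite-≢ zero       ()
  opposite-≢ (suc zero) ()

  self-or-opposite : ∀ a d → d ≡ a ⊎ d ≡ opposite a
  self-or-opposite zero       zero       = inj₁ refl
  self-or-opposite zero       (suc zero) = inj₂ refl
  self-or-opposite (suc zero) zero       = inj₂ refl
  self-or-opposite (suc zero) (suc zero) = inj₁ refl

  true≢false : true ≢ false
  true≢false ()

  allTrue : Initial 0
  allTrue _ = true

  trueOnlyAt : Agent 0 → Initial 0
  trueOnlyAt a d = does (d ≟ a)

  trueOnlyAt-opposite : ∀ a → trueOnlyAt a (opposite a) ≡ false
  trueOnlyAt-opposite a = dec-false (opposite a ≟ a) (opposite-≢ a ∘ sym)

  correctCall garbledReply : Agent 0 → Call 0
  correctCall  a = call a (opposite a) (opposite-≢ a) ok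
  garbledReply a = call a (opposite a) (opposite-≢ a) (errTo (opposite a))

  initial-∼ : ∀ a → (allTrue , ε) ∼[ a ] (trueOnlyAt a , ε)
  initial-∼ a = ∼-ε (sym (dec-true (a ≟ a) refl))

  garbledReply-∼ : ∀ a → (trueOnlyAt a , ε ∙ garbledReply a) ∼[ a ] (allTrue , ε ∙ correctCall a)
  garbledReply-∼ a = ∼-sym {1} (EqClosure.return (z≤n , s≤s z≤n ,
    ab-abe (opposite-≢ a) (opposite-≢ a) (initial-∼ a)
           (initHolding-flip {allTrue} {trueOnlyAt a} (opposite a)
                             (cong not (sym (trueOnlyAt-opposite a))))))

  -- cExp 0 a is definitionally ⋀ 0 (cExp-conjunct a); naming the conjunct
  -- lets ⋀-closed and ⋀-elim be instantiated.
  cExp-conjunct : Agent 0 → Agent 0 → Form 0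
  cExp-conjunct a b = _∨'_ 0 (atom b b true ∧' atom b a true ∧' ¬' atom b a false)
                             (atom b b false ∧' ¬' atom b a true ∧' atom b a false)

  cExp-after-correctCall : ∀ a → Sat 0 allTrue (ε ∙ correctCall a) (cExp 0 a)
  cExp-after-correctCall a =
    ⋀-closed (Sat 0 allTrue (ε ∙ correctCall a)) _,_ {cExp-conjunct a} λ d →
      λ (¬first , _) → ¬first (holds-own d , holds d , lacks-false d)
    where
      caller = role-caller {κ = ok} (opposite-≢ a)
      callee = role-callee {κ = ok} (opposite-≢ a)
      holds-own : ∀ d → hold allTrue (ε ∙ correctCall a) d (d , true)
      holds-own d with self-or-opposite a d
      ... | inj₁ refl = hold-∙-correct {κ = correctCall a} caller z≤n (inj₁ refl) λ ()
      ... | inj₂ refl = hold-∙-correct {κ = correctCall a} callee z≤n (inj₁ refl) λ ()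
      holds : ∀ d → hold allTrue (ε ∙ correctCall a) a (d , true)
      holds d with self-or-opposite a d
      ... | inj₁ refl = hold-∙-correct {κ = correctCall a} caller z≤n (inj₁ refl) λ ()
      ... | inj₂ refl = hold-∙-correct {κ = correctCall a} caller z≤n (inj₂ refl) λ ()
      lacks-false : ∀ d → ¬ hold allTrue (ε ∙ correctCall a) a (d , false)
      lacks-false d held
        with hold-∙-⊆ {a = a} {I = allTrue} {κ = correctCall a} {σ = ε} caller held
      ... | inj₁ ()
      ... | inj₂ ()

  cExp-fails-after-garbledReply : ∀ a → ¬ Sat 0 (trueOnlyAt a) (ε ∙ garbledReply a) (cExp 0 a)
  cExp-fails-after-garbledReply a cExp =
    ⋀-elim {I = trueOnlyAt a} {cExp-conjunct a} {ε ∙ garbledReply a} cExp b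
      ( (λ (b-holds-b , _) → b-lacks-b b-holds-b)
      , (λ (_ , ¬a-holds-b , _) → ¬a-holds-b a-holds-b))
    where
      b = opposite a
      b-lacks-b : ¬ hold (trueOnlyAt a) (ε ∙ garbledReply a) b (b , true)
      b-lacks-b held
        with hold-∙-⊆ {a = b} {I = trueOnlyAt a} {κ = garbledReply a} {σ = ε}
                      (role-callee (opposite-≢ a)) held
      ... | inj₁ own      = true≢false (trans (cong proj₂ own) (trueOnlyAt-opposite a))
      ... | inj₂ received = opposite-≢ a (sym (cong proj₁ received))
      a-holds-b : hold (trueOnlyAt a) (ε ∙ garbledReply a) a (b , true)
      a-holds-b =
        Updated⇒hold-∙ {a = a} {I = trueOnlyAt a} {κ = garbledReply a} {x = b , true} {ε}
          (role-caller (opposite-≢ a)) (inj₂ (received , ¬knows) , ¬excluded)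
        where
          received : swapV 0 b (b , true) ≡ (b , trueOnlyAt a b)
          received = trans (swapV-self b true) (cong (b ,_) (sym (trueOnlyAt-opposite a)))
          ¬knows : ¬ KnowsNot a (trueOnlyAt a) ε (b , true)
          ¬knows known = true≢false (sym (cong proj₂ (known allTrue ε z≤n (initial-∼ a))))
          ¬excluded : ¬ Excluded a b (just b) (trueOnlyAt a) ε (b , true)
          ¬excluded excluded = true≢false (sym (cong proj₂
            (excluded allTrue ε z≤n (∼-sym {0} (initial-∼ a))
                      (initHolding-flip {trueOnlyAt a} {allTrue} b (trueOnlyAt-opposite a)))))

  cExp-not-introspective :
    ∀ a → ¬ Sat 0 allTrue (ε ∙ correctCall a) (_↔'_ 0 (cExp 0 a) (K a (cExp 0 a)))
  cExp-not-introspective a (true⇒known , _) = true⇒known (cExp-after-correctCall a , ¬known)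
    where
      ¬known : ¬ Sat 0 allTrue (ε ∙ correctCall a) (K a (cExp 0 a))
      ¬known known = cExp-fails-after-garbledReply a (known _ _ (s≤s z≤n) (garbledReply-∼ a))

proposition2 :
    ((k : ℕ) (a : Agent k) →
      Valid k (_↔'_ k (Exp k a) (K {k} a (Exp k a))))
    × ((k : ℕ) (a : Agent k) →
      Valid k (_↔'_ k (¬'_ {k} (Exp k a)) (K {k} a (¬'_ {k} (Exp k a)))))
    × Σ ℕ (λ k → (a : Agent k) →
        Σ ℕ (λ m → Σ (Initial k) (λ I → Σ (Seq k m) (λ σ →
          IsCallSeq k σ × ¬ Sat k I σ (_↔'_ k (cExp k a) (K {k} a (cExp k a)))))))
proposition2 =
    (λ k a → local-introspective k (Exp-local k a))
  , (λ k a → local-introspective k (local-¬ (Exp-local k a)))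
  , (0 , λ a → 1 , allTrue , ε ∙ correctCall a , z≤n , cExp-not-introspective a)
  where
    open Gossip using (local-introspective; Exp-local; local-¬)
    open TwoAgents using (allTrue; correctCall; cExp-not-introspective)
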